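{- Let $\tau$ be a regular tame tree set. Then the graph $T(\tau)$ contains no cycle.
   Context: A separation system is a poset with an order-reversing involution $^*$ ($\overleftarrow s=\vec s^{\,*}$, $s=\{\vec s,\overleftarrow s\}$). Regular: no $\vec s\le\overleftarrow s$. Tree set: separations pairwise nested (comparable orientations), no trivial element ($\vec s\le\vec r,\overleftarrow r$ for some $r\neq s$). Tame: no chain of order type $\omega+1$. An orientation contains exactly one of $\vec s,\overleftarrow s$ for each $s$; consistent: $\vec r,\vec s\in O$, $\overleftarrow s\le\vec r$ imply $r=s$; splitting: consistent and every element lies below a maximal element of $O$. For $\vec s\in\tau$, $O(\vec s)$ is the unique consistent orientation of $\tau$ in which $\vec s$ is maximal (it is splitting). $T(\tau)$ is the graph with vertex set the set of splitting orientations of $\tau$ and edge set $\{\{O(\vec s),O(\overleftarrow s)\}:\vec s\in\tau\}$. -}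

module Defs where

open import Level using (Level; _⊔_) renaming (suc to lsuc)
open import Data.Nat using (ℕ; suc; _<_; _≤_)
open import Data.Product using (Σ; ∃; _×_; _,_)
open import Data.Sum using (_⊎_)
open import Data.Empty using (⊥)
open import Relation.Nullary using (¬_)
open import Relation.Binary.PropositionalEquality using (_≡_; _≢_)
open import Relation.Binary.Structures using (IsPartialOrder)

record SepSys (a ℓ : Level) : Set (lsuc (a ⊔ ℓ)) where
  infix 4 _≤ₛ_
  field
    Carrier        : Set a
    _≤ₛ_           : Carrier → Carrier → Set ℓ
    isPartialOrder : IsPartialOrder _≡_ _≤ₛ_
    _*             : Carrier → Carrier
    involutive     : ∀ x → (x *) * ≡ x
    orderReversing : ∀ {x y} → x ≤ₛ y → (y *) ≤ₛ (x *)

  _<ₛ_ : Carrier → Carrier → Set (a ⊔ ℓ)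
  x <ₛ y = (x ≤ₛ y) × (x ≢ y)

module _ {a ℓ : Level} (τ : SepSys a ℓ) where
  open SepSys τ

  Regular : Set (a ⊔ ℓ)
  Regular = ∀ x → ¬ (x ≤ₛ (x *))

  Nested : Carrier → Carrier → Set ℓ
  Nested x y = (x ≤ₛ y) ⊎ (x ≤ₛ (y *)) ⊎ ((x *) ≤ₛ y) ⊎ ((x *) ≤ₛ (y *))

  -- x is trivial: x ≤ y and x ≤ y* for some y whose separation r = {y , y*}
  -- differs from the separation s = {x , x*}
  Trivial : Carrier → Set (a ⊔ ℓ)
  Trivial x = Σ Carrier λ y → (y ≢ x) × (y ≢ (x *)) × (x ≤ₛ y) × (x ≤ₛ (y *))

  TreeSet : Set (a ⊔ ℓ)
  TreeSet = (∀ x y → Nested x y) × (∀ x → ¬ Trivial x)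

  -- tame: no chain of order type ω+1, i.e. no strictly increasing
  -- sequence f 0 < f 1 < ... with an element t above all of it
  Tame : Set (a ⊔ ℓ)
  Tame = ¬ (Σ (ℕ → Carrier) λ f → Σ Carrier λ t →
              (∀ n → f n <ₛ f (suc n)) × (∀ n → f n <ₛ t))

  Subset : Set (a ⊔ lsuc (a ⊔ ℓ))
  Subset = Carrier → Set (a ⊔ ℓ)

  IsOrientation : Subset → Set (a ⊔ ℓ)
  IsOrientation O = (∀ x → O x ⊎ O (x *)) × (∀ x → O x → ¬ O (x *))

  -- consistent: r, s ∈ O and s* ≤ r imply r = s (as unoriented separations)
  IsConsistent : Subset → Set (a ⊔ ℓ)
  IsConsistent O = IsOrientation O ×
    (∀ r s → O r → O s → (s *) ≤ₛ r → (r ≡ s) ⊎ (r ≡ (s *)))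

  MaximalIn : Subset → Carrier → Set (a ⊔ ℓ)
  MaximalIn O m = O m × (∀ y → O y → m ≤ₛ y → y ≡ m)

  IsSplitting : Subset → Set (a ⊔ ℓ)
  IsSplitting O = IsConsistent O ×
    (∀ x → O x → Σ Carrier λ m → MaximalIn O m × (x ≤ₛ m))

  _≈O_ : Subset → Subset → Set (a ⊔ ℓ)
  O ≈O O' = ∀ x → (O x → O' x) × (O' x → O x)

  -- O = O(x): O is the (unique) consistent orientation in which x is maximal
  IsO : Carrier → Subset → Set (a ⊔ ℓ)
  IsO x O = IsConsistent O × MaximalIn O x

  -- adjacency in T(τ): {O , O'} = {O(x) , O(x*)} for some x ∈ τ
  Adjacent : Subset → Subset → Set (a ⊔ ℓ)
  Adjacent O O' = Σ Carrier λ x → IsO x O × IsO (x *) O'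

  -- a cycle in T(τ): n ≥ 3 vertices v 0 , ... , v (n-1) (splitting
  -- orientations), pairwise distinct, with v i adjacent to v (i+1) for i < n
  -- and v n = v 0 (closing the cycle)
  Cycle : Set (lsuc (a ⊔ ℓ))
  Cycle = Σ ℕ λ n → Σ (ℕ → Subset) λ v →
      (3 ≤ n)
    × (∀ i → i < n → IsSplitting (v i))
    × (∀ i j → i < n → j < n → i ≢ j → ¬ (v i ≈O v j))
    × (∀ i → i < n → Adjacent (v i) (v (suc i)))
    × (v n ≈O v 0)

module Submission where

-- In a nested separation system every consistent
-- orientation O with x maximal is unique up to extensional equality, and two
-- maximal elements r , s of a consistent orientation are equal or satisfy
-- r ≤ s*.  Now walk around a cycle v 0 , … , v n = v 0 of T(τ): the i-th edge
-- is given by x i with v i = O(x i) and v (i+1) = O(x i *).  At the vertex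
-- v (i+1) both x i * and x (i+1) are maximal, so either x (i+1) ≤ x i, or
-- x (i+1) = x i * and the walk returns: v (i+2) = O(x i) = v i, which the
-- distinctness of the cycle forbids.  Hence x (n-1) ≤ … ≤ x 1 ≤ x 0, and the
-- same argument at the closing vertex v n = v 0 gives x 0 ≤ x (n-1).  So
-- x 1 = x 0, but x 1 and x 0 * both lie in the orientation v 1: contradiction.

open import Defs
open import Level using (Level)
open import Relation.Nullary using (¬_)
open import Data.Nat using (ℕ; suc; _+_; _<_; _≤_; s≤s; z≤n)
open import Data.Nat.Properties
  using (<-irrelevant; m≤n⇒m<n∨m≡n; ≤-refl; n≤1+n; ≤-trans)
open import Data.Product using (_,_; proj₁; proj₂)
open import Data.Sum using (_⊎_; inj₁; inj₂)
open import Data.Empty using (⊥; ⊥-elim)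
open import Relation.Binary.PropositionalEquality
  using (_≡_; _≢_; refl; sym; trans; subst; subst₂; cong)
open import Relation.Binary.Structures using (IsPartialOrder)

module OrientationBasics {a ℓ : Level} (τ : SepSys a ℓ) where
  open SepSys τ

  ≤*⇒≤* : ∀ {x y} → x ≤ₛ (y *) → y ≤ₛ (x *)
  ≤*⇒≤* {x} {y} x≤y* = subst (_≤ₛ (x *)) (involutive y) (orderReversing x≤y*)

  *-reflects-≤ : ∀ {x y} → (x *) ≤ₛ (y *) → y ≤ₛ x
  *-reflects-≤ {x} {y} x*≤y* =
    subst₂ _≤ₛ_ (involutive y) (involutive x) (orderReversing x*≤y*)

  ≈O-trans : ∀ {O O' O''} → _≈O_ τ O O' → _≈O_ τ O' O'' → _≈O_ τ O O''
  ≈O-trans e f y = (λ z → proj₁ (f y) (proj₁ (e y) z))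
                 , (λ z → proj₂ (e y) (proj₂ (f y) z))

  ≈O-refl : ∀ {O} → _≈O_ τ O O
  ≈O-refl y = (λ z → z) , (λ z → z)

  maximal-resp-≈O : ∀ {O O' m} → _≈O_ τ O O' → MaximalIn τ O m → MaximalIn τ O' m
  maximal-resp-≈O {m = m} e (mO , maxm) =
    proj₁ (e m) mO , λ y yO' m≤y → maxm y (proj₂ (e y) yO') m≤y

  IsO-excludes-inverse : ∀ {x O} → IsO τ x O → ¬ O (x *)
  IsO-excludes-inverse (((_ , exclusive) , _) , (xO , _)) = exclusive _ xO

module NestedOrientations {a ℓ : Level} (τ : SepSys a ℓ)
                          (nested : ∀ x y → Nested τ x y) where
  open SepSys τ
  open OrientationBasics τ public

  O-unique-⊆ : ∀ {O O' x} → IsO τ x O → IsO τ x O' → ∀ y → O y → O' y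
  O-unique-⊆ {O} {O'} {x} (((_ , exO) , conO) , (xO , maxO))
                         (((totO' , exO') , conO') , (xO' , maxO')) y yO
    with totO' y
  ... | inj₁ yO' = yO'
  ... | inj₂ y*O' = ⊥-elim (refute (nested y x))
    where
    -- y ∈ O and y* ∈ O'; each way of nesting y with x yields a clash.
    refute : Nested τ y x → ⊥
    refute (inj₁ y≤x) with conO' x (y *) xO' y*O'
                                  (subst (_≤ₛ x) (sym (involutive y)) y≤x)
    ... | inj₁ x≡y* = exO y yO (subst O x≡y* xO)
    ... | inj₂ x≡y** = exO' (y *) y*O' (subst O' x≡y** xO')
    refute (inj₂ (inj₁ y≤x*)) =
      exO y yO (subst O (sym (maxO' (y *) y*O' (≤*⇒≤* y≤x*))) xO)
    refute (inj₂ (inj₂ (inj₁ y*≤x))) with conO x y xO yO y*≤x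
    ... | inj₁ x≡y = exO' y (subst O' x≡y xO') y*O'
    ... | inj₂ x≡y* = exO y yO (subst O x≡y* xO)
    refute (inj₂ (inj₂ (inj₂ y*≤x*))) =
      exO' x xO' (subst (λ z → O' (z *)) (maxO y yO (*-reflects-≤ y*≤x*)) y*O')

  O-unique : ∀ {O O' x} → IsO τ x O → IsO τ x O' → _≈O_ τ O O'
  O-unique A B y = O-unique-⊆ A B y , O-unique-⊆ B A y

  maximal-pair : ∀ {O r s} → IsConsistent τ O → MaximalIn τ O r → MaximalIn τ O s →
                 (r ≡ s) ⊎ (r ≤ₛ (s *))
  maximal-pair {O} {r} {s} ((_ , exclusive) , consistent) (rO , maxr) (sO , maxs)
    with nested r s
  ... | inj₁ r≤s = inj₁ (sym (maxr s sO r≤s))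
  ... | inj₂ (inj₁ r≤s*) = inj₂ r≤s*
  ... | inj₂ (inj₂ (inj₂ r*≤s*)) = inj₁ (maxs r rO (*-reflects-≤ r*≤s*))
  ... | inj₂ (inj₂ (inj₁ r*≤s)) with consistent s r sO rO r*≤s
  ...   | inj₁ s≡r = inj₁ (sym s≡r)
  ...   | inj₂ s≡r* = ⊥-elim (exclusive r rO (subst O s≡r* sO))

  -- Two consecutive edges O(x) — O(x*) ≈ O(y) — O(y*) of T(τ) either
  -- descend (y ≤ x) or the second one walks straight back (O(y*) ≈ O(x)).
  descend-or-return : ∀ {x y O P P' Q} →
    IsO τ x O → IsO τ (x *) P → _≈O_ τ P P' → IsO τ y P' → IsO τ (y *) Q →
    (y ≤ₛ x) ⊎ (_≈O_ τ O Q)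
  descend-or-return {x} {y} {Q = Q} Ox Px* P≈P' (P'cons , P'maxy) Qy*
    with maximal-pair P'cons (maximal-resp-≈O P≈P' (proj₂ Px*)) P'maxy
  ... | inj₂ x*≤y* = inj₁ (*-reflects-≤ x*≤y*)
  ... | inj₁ x*≡y = inj₂ (O-unique Ox (subst (λ z → IsO τ z Q) y*≡x Qy*))
    where
    y*≡x : y * ≡ x
    y*≡x = trans (cong _* (sym x*≡y)) (involutive x)

module CycleContradiction {a ℓ : Level} (τ : SepSys a ℓ)
         (nested : ∀ x y → Nested τ x y) (k : ℕ) (v : ℕ → Subset τ)
         (distinct : ∀ i j → i < 3 + k → j < 3 + k → i ≢ j → ¬ (_≈O_ τ (v i) (v j)))
         (adjacent : ∀ i → i < 3 + k → Adjacent τ (v i) (v (suc i)))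
         (closes : _≈O_ τ (v (3 + k)) (v 0)) where
  open SepSys τ
  open IsPartialOrder isPartialOrder
    using (antisym) renaming (refl to ≤ₛ-refl; trans to ≤ₛ-trans)
  open NestedOrientations τ nested

  n L : ℕ
  n = 3 + k
  L = 2 + k    -- index of the last edge

  x : ∀ i → i < n → Carrier
  x i p = proj₁ (adjacent i p)

  tail-of : ∀ i (p : i < n) → IsO τ (x i p) (v i)
  tail-of i p = proj₁ (proj₂ (adjacent i p))

  head-of : ∀ i (p : i < n) → IsO τ (x i p *) (v (suc i))
  head-of i p = proj₂ (proj₂ (adjacent i p))

  p0 : 0 < n
  p0 = s≤s z≤n

  p1 : 1 < n
  p1 = s≤s (s≤s z≤n)

  pL : L < n
  pL = ≤-refl

  -- Distinctness forbids the walk to return after two steps; for i + 2 = n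
  -- this uses v n ≈ v 0.
  no-return : ∀ i → suc (suc i) ≤ n → ¬ (_≈O_ τ (v i) (v (suc (suc i))))
  no-return i i+2≤n back with m≤n⇒m<n∨m≡n i+2≤n
  ... | inj₁ i+2<n =
    distinct i (suc (suc i)) (≤-trans (≤-trans (n≤1+n _) (n≤1+n _)) i+2<n) i+2<n
             (λ ()) back
  ... | inj₂ refl = distinct (suc k) 0 (n≤1+n _) p0 (λ ()) (≈O-trans back closes)

  descent : ∀ i (p : i < n) (q : suc i < n) → x (suc i) q ≤ₛ x i p
  descent i p q with descend-or-return (tail-of i p) (head-of i p) ≈O-refl
                                       (tail-of (suc i) q) (head-of (suc i) q)
  ... | inj₁ x[i+1]≤x[i] = x[i+1]≤x[i]
  ... | inj₂ back = ⊥-elim (no-return i q back)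

  descending : ∀ i j (p : i < n) (q : j < n) → i ≤ j → x j q ≤ₛ x i p
  descending i j p q i≤j with m≤n⇒m<n∨m≡n i≤j
  ... | inj₂ refl = subst (λ r → x i q ≤ₛ x i r) (<-irrelevant q p) ≤ₛ-refl
  descending i (suc j) p q _ | inj₁ (s≤s i≤j) =
    ≤ₛ-trans (descent j q′ q) (descending i j p q′ i≤j)
    where
    q′ : j < n
    q′ = ≤-trans (n≤1+n _) q

  -- At the closing vertex v n ≈ v 0 the last edge and the first edge meet.
  closing : x 0 p0 ≤ₛ x L pL
  closing with descend-or-return (tail-of L pL) (head-of L pL) closes
                                 (tail-of 0 p0) (head-of 0 p0)
  ... | inj₁ x[0]≤x[L] = x[0]≤x[L]
  ... | inj₂ back = ⊥-elim (distinct L 1 pL p1 (λ ()) back)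

  -- x 0 ≤ x L ≤ x 1 ≤ x 0, so x 1 = x 0; yet x 1 and x 0 * both lie in v 1.
  absurd : ⊥
  absurd = IsO-excludes-inverse (subst (λ z → IsO τ z (v 1)) x[1]≡x[0] (tail-of 1 p1))
                                (proj₁ (proj₂ (head-of 0 p0)))
    where
    x[1]≡x[0] : x 1 p1 ≡ x 0 p0
    x[1]≡x[0] = antisym (descent 0 p0 p1)
                        (≤ₛ-trans closing (descending 1 L p1 pL (s≤s z≤n)))

lemma3p4 : {a ℓ : Level} (τ : SepSys a ℓ) → Regular τ → TreeSet τ → Tame τ → ¬ Cycle τ
lemma3p4 τ _ (nested , _) _
         (_ , v , s≤s (s≤s (s≤s (z≤n {k}))) , _ , distinct , adjacent , closes) =
  CycleContradiction.absurd τ nested k v distinct adjacent closes
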